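{- Let $S$ be a closed type of System $\mathcal F$ and $O$ a type constant not occurring in $S$. Then $S$ is an output type if and only if for every $\beta$-normal $\lambda$-term $t$, for all types $A_1,\dots,A_r$ that end with $O$, and all variables $x_1,\dots,x_r$: if $x_1:A_1,\dots,x_r:A_r\vdash_{\mathcal F}t:S$, then $x_i\notin Fv(t)$ for every $1\le i\le r$.
   Context: System $\mathcal F$: types are built from type variables and type constants with $\rightarrow$ and $\forall$ (only types where quantified variables occur in their scope); typing of pure $\lambda$-terms by (ax); ($\rightarrow_i$) from $\Gamma,x:B\vdash t:C$ infer $\Gamma\vdash\lambda xt:B\rightarrow C$; ($\rightarrow_e$) from $\Gamma\vdash u:B\rightarrow C$, $\Gamma\vdash v:B$ infer $\Gamma\vdash(u)v:C$; ($\forall_i$) from $\Gamma\vdash t:A$, $X$ not free in $\Gamma$, infer $\Gamma\vdash t:\forall XA$; ($\forall_e$) from $\Gamma\vdash t:\forall XA$ infer $\Gamma\vdash t:A[C/X]$. $Fv(t)$ is the set of free variables of $t$. A closed type $S$ is an output type iff for every $\beta$-normal $t$, $\vdash_{\mathcal F}\lambda xt:\forall X(X\rightarrow S)$ implies $x\notin Fv(t)$ (equivalently: $\alpha:O\vdash_{\mathcal F}t:S$ with $t$ normal implies $\alpha\notin Fv(t)$). For a type variable or constant $K$, the types ending with $K$ are generated by: $K$ ends with $K$; if $A$ ends with $K$ then $B\rightarrow A$ ends with $K$ for every type $B$; if $A$ ends with $K$ then $\forall XA$ ends with $K$ for every type variable $X\neq K$. -}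

module Defs where

open import Data.Nat using (ℕ; zero; suc)
open import Data.Product using (_×_; _,_; proj₁; proj₂)
open import Data.List using (List; []; _∷_; map)
open import Relation.Binary.PropositionalEquality using (_≡_; _≢_)
open import Relation.Nullary using (¬_)

-- Types of System F.  Type variables are de Bruijn indices (so that
-- substitution is capture-avoiding and "X not free in Γ" becomes a
-- shift of Γ); type constants are named by natural numbers.

infixr 7 _⇒_
data Ty : Set where
  tv  : ℕ → Ty
  tc  : ℕ → Ty
  _⇒_ : Ty → Ty → Ty
  ∀'  : Ty → Ty         -- ∀X A, X bound as index 0 in A

ext : (ℕ → ℕ) → ℕ → ℕ
ext ρ zero    = zero
ext ρ (suc n) = suc (ρ n)

ren : (ℕ → ℕ) → Ty → Ty
ren ρ (tv n)  = tv (ρ n)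
ren ρ (tc c)  = tc c
ren ρ (A ⇒ B) = ren ρ A ⇒ ren ρ B
ren ρ (∀' A)  = ∀' (ren (ext ρ) A)

exts : (ℕ → Ty) → ℕ → Ty
exts σ zero    = tv zero
exts σ (suc n) = ren suc (σ n)

sub : (ℕ → Ty) → Ty → Ty
sub σ (tv n)  = σ n
sub σ (tc c)  = tc c
sub σ (A ⇒ B) = sub σ A ⇒ sub σ B
sub σ (∀' A)  = ∀' (sub (exts σ) A)

single : Ty → ℕ → Ty
single C zero    = C
single C (suc n) = tv n

_[_] : Ty → Ty → Ty
A [ C ] = sub (single C) A

data FreeTV : ℕ → Ty → Set where
  here : ∀ {n} → FreeTV n (tv n)
  ⇒ˡ   : ∀ {n A B} → FreeTV n A → FreeTV n (A ⇒ B)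
  ⇒ʳ   : ∀ {n A B} → FreeTV n B → FreeTV n (A ⇒ B)
  all  : ∀ {n A} → FreeTV (suc n) A → FreeTV n (∀' A)

data OccursTC : ℕ → Ty → Set where
  here : ∀ {c} → OccursTC c (tc c)
  ⇒ˡ   : ∀ {c A B} → OccursTC c A → OccursTC c (A ⇒ B)
  ⇒ʳ   : ∀ {c A B} → OccursTC c B → OccursTC c (A ⇒ B)
  all  : ∀ {c A} → OccursTC c A → OccursTC c (∀' A)

ClosedTy : Ty → Set
ClosedTy A = ∀ n → ¬ FreeTV n A

data WF : Ty → Set where
  tv  : ∀ {n} → WF (tv n)
  tc  : ∀ {c} → WF (tc c)
  _⇒_ : ∀ {A B} → WF A → WF B → WF (A ⇒ B)
  ∀'  : ∀ {A} → WF A → FreeTV zero A → WF (∀' A)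

data EndsWith (O : ℕ) : Ty → Set where
  base : EndsWith O (tc O)
  arr  : ∀ {A} B → EndsWith O A → EndsWith O (B ⇒ A)
  all  : ∀ {A} → EndsWith O A → EndsWith O (∀' A)

data Term : Set where
  var : ℕ → Term
  lam : ℕ → Term → Term
  app : Term → Term → Term

data _∈Fv_ : ℕ → Term → Set where
  var  : ∀ {x} → x ∈Fv var x
  lam  : ∀ {x y t} → x ≢ y → x ∈Fv t → x ∈Fv lam y t
  appˡ : ∀ {x t u} → x ∈Fv t → x ∈Fv app t u
  appʳ : ∀ {x t u} → x ∈Fv u → x ∈Fv app t u

data Normal : Term → Set
data Neutral : Term → Set
data Normal where
  lam : ∀ {x t} → Normal t → Normal (lam x t)
  ne  : ∀ {t} → Neutral t → Normal t
data Neutral where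
  var : ∀ {x} → Neutral (var x)
  app : ∀ {t u} → Neutral t → Normal u → Neutral (app t u)

Ctx : Set
Ctx = List (ℕ × Ty)

-- lookup of the most recent declaration of x
data _∋_∶_ : Ctx → ℕ → Ty → Set where
  here  : ∀ {Γ x A} → ((x , A) ∷ Γ) ∋ x ∶ A
  there : ∀ {Γ x y A B} → x ≢ y → Γ ∋ x ∶ A → ((y , B) ∷ Γ) ∋ x ∶ A

shiftCtx : Ctx → Ctx
shiftCtx = map (λ p → proj₁ p , ren suc (proj₂ p))

infix 4 _⊢_∶_
data _⊢_∶_ : Ctx → Term → Ty → Set where
  ax  : ∀ {Γ x A} → Γ ∋ x ∶ A → Γ ⊢ var x ∶ A
  →i  : ∀ {Γ x t B C} → WF B → ((x , B) ∷ Γ) ⊢ t ∶ C → Γ ⊢ lam x t ∶ B ⇒ C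
  →e  : ∀ {Γ u v B C} → Γ ⊢ u ∶ B ⇒ C → Γ ⊢ v ∶ B → Γ ⊢ app u v ∶ C
  ∀i  : ∀ {Γ t A} → shiftCtx Γ ⊢ t ∶ A → FreeTV zero A → Γ ⊢ t ∶ ∀' A
  ∀e  : ∀ {Γ t A C} → Γ ⊢ t ∶ ∀' A → WF C → Γ ⊢ t ∶ A [ C ]

Output : Ty → Set
Output S = ∀ (x : ℕ) (t : Term) → Normal t →
  [] ⊢ lam x t ∶ ∀' (tv zero ⇒ ren suc S) → ¬ (x ∈Fv t)

module Submission where

-- Both directions go through the judgement  x : O ⊢ t : S.
-- * Backward: by the generation lemma for λ, a derivation of
--   ⊢ λx t : ∀X (X → S) yields x : O ⊢ t : S, and O ends with O.
-- * Forward: conversely, x : O ⊢ t : S yields ⊢ λx t : ∀X (X → S) by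
--   substituting the fresh type variable X for O in the whole derivation.
--   Given Γ ⊢ t : S with all types of Γ ending with O, we translate t into
--   a normal t' with α : O ⊢ t' : S, where α is a fresh variable: every
--   maximal application spine headed by a Γ-variable has a type ending
--   with O, and is replaced by a normal inhabitant of that type built
--   from α. Any Γ-variable free in t makes α free in t', which the output
--   property forbids.

open import Defs
open import Data.Nat using (ℕ; zero; suc; _≟_; _<_; _⊔_)
open import Data.Nat.Properties using (<⇒≢; m⊔n<o⇒m<o; m⊔n<o⇒n<o; n<1+n; 1+n≢n)
open import Data.Product using (_×_; _,_; proj₁; proj₂)
open import Data.Sum using (_⊎_; inj₁; inj₂; [_,_]′; map₂)
open import Data.List using (List; []; _∷_; _++_; map)
open import Data.List.Properties using (map-++; map-∘; map-cong; map-id)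
open import Data.List.Membership.Propositional using (_∈_; _∉_)
open import Data.List.Relation.Unary.Any using (here; there)
open import Data.List.Relation.Unary.All using (All; []; _∷_; head; tabulate)
  renaming (map to All-map)
open import Data.List.Relation.Unary.All.Properties using (map⁺)
open import Data.Empty using (⊥-elim)
open import Function.Base using (_∘_)
open import Function.Bundles using (_⇔_; mk⇔)
open import Relation.Nullary using (¬_; yes; no)
open import Relation.Binary.PropositionalEquality
  using (_≡_; _≢_; refl; sym; trans; cong; cong₂; subst; subst₂; module ≡-Reasoning)

-- Simultaneous substitution of type variables and type constants

csub : (ℕ → Ty) → (ℕ → Ty) → Ty → Ty
csub σ τ (tv n)  = σ n
csub σ τ (tc c)  = τ c
csub σ τ (A ⇒ B) = csub σ τ A ⇒ csub σ τ B
csub σ τ (∀' A)  = ∀' (csub (exts σ) (ren suc ∘ τ) A)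

ren-cong : ∀ {ρ ρ'} → (∀ n → ρ n ≡ ρ' n) → ∀ A → ren ρ A ≡ ren ρ' A
ren-cong e (tv n)  = cong tv (e n)
ren-cong e (tc c)  = refl
ren-cong e (A ⇒ B) = cong₂ _⇒_ (ren-cong e A) (ren-cong e B)
ren-cong e (∀' A)  = cong ∀' (ren-cong e' A)
  where
  e' : ∀ n → ext _ n ≡ ext _ n
  e' zero    = refl
  e' (suc n) = cong suc (e n)

csub-cong : ∀ {σ σ' τ τ'} → (∀ n → σ n ≡ σ' n) → (∀ c → τ c ≡ τ' c) →
            ∀ A → csub σ τ A ≡ csub σ' τ' A
csub-cong e f (tv n)  = e n
csub-cong e f (tc c)  = f c
csub-cong e f (A ⇒ B) = cong₂ _⇒_ (csub-cong e f A) (csub-cong e f B)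
csub-cong e f (∀' A)  = cong ∀' (csub-cong e' (cong (ren suc) ∘ f) A)
  where
  e' : ∀ n → exts _ n ≡ exts _ n
  e' zero    = refl
  e' (suc n) = cong (ren suc) (e n)

ren-ren : ∀ ρ ρ' A → ren ρ (ren ρ' A) ≡ ren (ρ ∘ ρ') A
ren-ren ρ ρ' (tv n)  = refl
ren-ren ρ ρ' (tc c)  = refl
ren-ren ρ ρ' (A ⇒ B) = cong₂ _⇒_ (ren-ren ρ ρ' A) (ren-ren ρ ρ' B)
ren-ren ρ ρ' (∀' A)  =
  cong ∀' (trans (ren-ren (ext ρ) (ext ρ') A) (ren-cong ext-∘ A))
  where
  ext-∘ : ∀ n → ext ρ (ext ρ' n) ≡ ext (ρ ∘ ρ') n
  ext-∘ zero    = refl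
  ext-∘ (suc n) = refl

ren-shift : ∀ ρ A → ren (ext ρ) (ren suc A) ≡ ren suc (ren ρ A)
ren-shift ρ A = trans (ren-ren (ext ρ) suc A) (sym (ren-ren suc ρ A))

ren-csub : ∀ ρ σ τ A → ren ρ (csub σ τ A) ≡ csub (ren ρ ∘ σ) (ren ρ ∘ τ) A
ren-csub ρ σ τ (tv n)  = refl
ren-csub ρ σ τ (tc c)  = refl
ren-csub ρ σ τ (A ⇒ B) = cong₂ _⇒_ (ren-csub ρ σ τ A) (ren-csub ρ σ τ B)
ren-csub ρ σ τ (∀' A)  =
  cong ∀' (trans (ren-csub (ext ρ) (exts σ) (ren suc ∘ τ) A)
                 (csub-cong exts-ren (ren-shift ρ ∘ τ) A))
  where
  exts-ren : ∀ n → ren (ext ρ) (exts σ n) ≡ exts (ren ρ ∘ σ) n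
  exts-ren zero    = refl
  exts-ren (suc n) = ren-shift ρ (σ n)

csub-ren : ∀ σ τ ρ A → csub σ τ (ren ρ A) ≡ csub (σ ∘ ρ) τ A
csub-ren σ τ ρ (tv n)  = refl
csub-ren σ τ ρ (tc c)  = refl
csub-ren σ τ ρ (A ⇒ B) = cong₂ _⇒_ (csub-ren σ τ ρ A) (csub-ren σ τ ρ B)
csub-ren σ τ ρ (∀' A)  =
  cong ∀' (trans (csub-ren (exts σ) (ren suc ∘ τ) (ext ρ) A)
                 (csub-cong exts-ext (λ _ → refl) A))
  where
  exts-ext : ∀ n → exts σ (ext ρ n) ≡ exts (σ ∘ ρ) n
  exts-ext zero    = refl
  exts-ext (suc n) = refl

csub-shift : ∀ σ τ B → csub (exts σ) (ren suc ∘ τ) (ren suc B) ≡ ren suc (csub σ τ B)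
csub-shift σ τ B = trans (csub-ren (exts σ) (ren suc ∘ τ) suc B) (sym (ren-csub suc σ τ B))

csub-csub : ∀ σ τ σ' τ' A →
            csub σ τ (csub σ' τ' A) ≡ csub (csub σ τ ∘ σ') (csub σ τ ∘ τ') A
csub-csub σ τ σ' τ' (tv n)  = refl
csub-csub σ τ σ' τ' (tc c)  = refl
csub-csub σ τ σ' τ' (A ⇒ B) = cong₂ _⇒_ (csub-csub σ τ σ' τ' A) (csub-csub σ τ σ' τ' B)
csub-csub σ τ σ' τ' (∀' A)  =
  cong ∀' (trans (csub-csub (exts σ) (ren suc ∘ τ) (exts σ') (ren suc ∘ τ') A)
                 (csub-cong exts-csub (csub-shift σ τ ∘ τ') A))
  where
  exts-csub : ∀ n → csub (exts σ) (ren suc ∘ τ) (exts σ' n) ≡ exts (csub σ τ ∘ σ') n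
  exts-csub zero    = refl
  exts-csub (suc n) = csub-shift σ τ (σ' n)

csub-fix : ∀ σ τ A → (∀ n → FreeTV n A → σ n ≡ tv n) →
           (∀ c → OccursTC c A → τ c ≡ tc c) → csub σ τ A ≡ A
csub-fix σ τ (tv n)  p q = p n here
csub-fix σ τ (tc c)  p q = q c here
csub-fix σ τ (A ⇒ B) p q =
  cong₂ _⇒_ (csub-fix σ τ A (λ n → p n ∘ ⇒ˡ) (λ c → q c ∘ ⇒ˡ))
            (csub-fix σ τ B (λ n → p n ∘ ⇒ʳ) (λ c → q c ∘ ⇒ʳ))
csub-fix σ τ (∀' A)  p q = cong ∀' (csub-fix (exts σ) (ren suc ∘ τ) A p' q')
  where
  p' : ∀ n → FreeTV n A → exts σ n ≡ tv n
  p' zero    _ = refl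
  p' (suc n) f = cong (ren suc) (p n (all f))
  q' : ∀ c → OccursTC c A → ren suc (τ c) ≡ tc c
  q' c o = cong (ren suc) (q c (all o))

csub-id : ∀ A → csub tv tc A ≡ A
csub-id A = csub-fix tv tc A (λ _ _ → refl) (λ _ _ → refl)

ren-as-csub : ∀ ρ A → ren ρ A ≡ csub (tv ∘ ρ) tc A
ren-as-csub ρ (tv n)  = refl
ren-as-csub ρ (tc c)  = refl
ren-as-csub ρ (A ⇒ B) = cong₂ _⇒_ (ren-as-csub ρ A) (ren-as-csub ρ B)
ren-as-csub ρ (∀' A)  = cong ∀' (trans (ren-as-csub (ext ρ) A) (csub-cong tv-ext (λ _ → refl) A))
  where
  tv-ext : ∀ n → tv (ext ρ n) ≡ exts (tv ∘ ρ) n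
  tv-ext zero    = refl
  tv-ext (suc n) = refl

sub-as-csub : ∀ σ A → sub σ A ≡ csub σ tc A
sub-as-csub σ (tv n)  = refl
sub-as-csub σ (tc c)  = refl
sub-as-csub σ (A ⇒ B) = cong₂ _⇒_ (sub-as-csub σ A) (sub-as-csub σ B)
sub-as-csub σ (∀' A)  = cong ∀' (sub-as-csub (exts σ) A)

inst-shifted : ∀ C B → csub (single C) tc (ren suc B) ≡ B
inst-shifted C B = trans (csub-ren (single C) tc suc B) (csub-id B)

-- Substitution commutes with instantiation: needed for the ∀e rule.
csub-inst : ∀ σ τ A C →
            csub σ τ (A [ C ]) ≡ (csub (exts σ) (ren suc ∘ τ) A) [ csub σ τ C ]
csub-inst σ τ A C = begin
  csub σ τ (A [ C ])
    ≡⟨ cong (csub σ τ) (sub-as-csub (single C) A) ⟩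
  csub σ τ (csub (single C) tc A)
    ≡⟨ csub-csub σ τ (single C) tc A ⟩
  csub (csub σ τ ∘ single C) τ A
    ≡⟨ csub-cong single-exts (sym ∘ inst-shifted C' ∘ τ) A ⟩
  csub (csub (single C') tc ∘ exts σ) (csub (single C') tc ∘ ren suc ∘ τ) A
    ≡⟨ sym (csub-csub (single C') tc (exts σ) (ren suc ∘ τ) A) ⟩
  csub (single C') tc (csub (exts σ) (ren suc ∘ τ) A)
    ≡⟨ sym (sub-as-csub (single C') (csub (exts σ) (ren suc ∘ τ) A)) ⟩
  (csub (exts σ) (ren suc ∘ τ) A) [ C' ] ∎
  where
  open ≡-Reasoning
  C' = csub σ τ C
  single-exts : ∀ n → csub σ τ (single C n) ≡ csub (single C') tc (exts σ n)
  single-exts zero    = refl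
  single-exts (suc n) = sym (inst-shifted C' (σ n))

FreeTV-ren : ∀ ρ {n A} → FreeTV n A → FreeTV (ρ n) (ren ρ A)
FreeTV-ren ρ here    = here
FreeTV-ren ρ (⇒ˡ f)  = ⇒ˡ (FreeTV-ren ρ f)
FreeTV-ren ρ (⇒ʳ f)  = ⇒ʳ (FreeTV-ren ρ f)
FreeTV-ren ρ (all f) = all (FreeTV-ren (ext ρ) f)

FreeTV-csub : ∀ σ τ {n m A} → FreeTV n A → FreeTV m (σ n) → FreeTV m (csub σ τ A)
FreeTV-csub σ τ here    h = h
FreeTV-csub σ τ (⇒ˡ f)  h = ⇒ˡ (FreeTV-csub σ τ f h)
FreeTV-csub σ τ (⇒ʳ f)  h = ⇒ʳ (FreeTV-csub σ τ f h)
FreeTV-csub σ τ (all f) h = all (FreeTV-csub (exts σ) (ren suc ∘ τ) f (FreeTV-ren suc h))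

WF-ren : ∀ ρ {A} → WF A → WF (ren ρ A)
WF-ren ρ tv         = tv
WF-ren ρ tc         = tc
WF-ren ρ (w ⇒ w')   = WF-ren ρ w ⇒ WF-ren ρ w'
WF-ren ρ (∀' w f)   = ∀' (WF-ren (ext ρ) w) (FreeTV-ren (ext ρ) f)

WF-csub : ∀ σ τ → (∀ n → WF (σ n)) → (∀ c → WF (τ c)) → ∀ {A} → WF A → WF (csub σ τ A)
WF-csub σ τ ws wt tv       = ws _
WF-csub σ τ ws wt tc       = wt _
WF-csub σ τ ws wt (w ⇒ w') = WF-csub σ τ ws wt w ⇒ WF-csub σ τ ws wt w'
WF-csub σ τ ws wt (∀' w f) =
  ∀' (WF-csub (exts σ) (ren suc ∘ τ) ws' (WF-ren suc ∘ wt) w)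
     (FreeTV-csub (exts σ) (ren suc ∘ τ) f here)
  where
  ws' : ∀ n → WF (exts σ n)
  ws' zero    = tv
  ws' (suc n) = WF-ren suc (ws n)

WF-inst : ∀ {A C} → WF A → WF C → WF (A [ C ])
WF-inst {A} {C} wA wC =
  subst WF (sym (sub-as-csub (single C) A)) (WF-csub (single C) tc single-WF (λ _ → tc) wA)
  where
  single-WF : ∀ n → WF (single C n)
  single-WF zero    = wC
  single-WF (suc n) = tv

EndsWith-ren : ∀ {O} ρ {A} → EndsWith O A → EndsWith O (ren ρ A)
EndsWith-ren ρ base      = base
EndsWith-ren ρ (arr B e) = arr (ren ρ B) (EndsWith-ren ρ e)
EndsWith-ren ρ (all e)   = all (EndsWith-ren (ext ρ) e)

EndsWith-sub : ∀ {O} σ {A} → EndsWith O A → EndsWith O (sub σ A)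
EndsWith-sub σ base      = base
EndsWith-sub σ (arr B e) = arr (sub σ B) (EndsWith-sub σ e)
EndsWith-sub σ (all e)   = all (EndsWith-sub (exts σ) e)

mapCtx : (Ty → Ty) → Ctx → Ctx
mapCtx f = map (λ p → proj₁ p , f (proj₂ p))

names : Ctx → List ℕ
names = map proj₁

names-shift : ∀ Λ → names (shiftCtx Λ) ≡ names Λ
names-shift Λ = sym (map-∘ Λ)

shift-++ : ∀ Λ Γ → shiftCtx (Λ ++ Γ) ≡ shiftCtx Λ ++ shiftCtx Γ
shift-++ = map-++ _

lookup-map : ∀ f {Γ x A} → Γ ∋ x ∶ A → mapCtx f Γ ∋ x ∶ f A
lookup-map f here         = here
lookup-map f (there nq l) = there nq (lookup-map f l)

lookup-All : ∀ {P : ℕ × Ty → Set} {Γ y T} → Γ ∋ y ∶ T → All P Γ → P (y , T)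
lookup-All here        (p ∷ _) = p
lookup-All (there _ l) (_ ∷ a) = lookup-All l a

lookup-++ : ∀ Λ {Γ y T} → (Λ ++ Γ) ∋ y ∶ T →
            (y ∈ names Λ × (∀ {Γ'} → (Λ ++ Γ') ∋ y ∶ T)) ⊎ Γ ∋ y ∶ T
lookup-++ []      l               = inj₂ l
lookup-++ (p ∷ Λ) here            = inj₁ (here refl , here)
lookup-++ (p ∷ Λ) (there y≢z l) with lookup-++ Λ l
... | inj₁ (y∈Λ , l') = inj₁ (there y∈Λ , there y≢z l')
... | inj₂ l'         = inj₂ l'

lookup-last : ∀ Λ {x A} → x ∉ names Λ → (Λ ++ (x , A) ∷ []) ∋ x ∶ A
lookup-last []            x∉ = here
lookup-last ((z , B) ∷ Λ) x∉ =
  there (x∉ ∘ here) (lookup-last Λ (x∉ ∘ there))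

⊢-csub : ∀ σ τ → (∀ n → WF (σ n)) → (∀ c → WF (τ c)) →
         ∀ {Γ t A} → Γ ⊢ t ∶ A → mapCtx (csub σ τ) Γ ⊢ t ∶ csub σ τ A
⊢-csub σ τ ws wt (ax l)     = ax (lookup-map _ l)
⊢-csub σ τ ws wt (→i w D)   = →i (WF-csub σ τ ws wt w) (⊢-csub σ τ ws wt D)
⊢-csub σ τ ws wt (→e D D')  = →e (⊢-csub σ τ ws wt D) (⊢-csub σ τ ws wt D')
⊢-csub σ τ ws wt (∀i {Γ = Γ} {t = t} {A = A} D f) =
  ∀i (subst (λ Δ → Δ ⊢ t ∶ csub (exts σ) τ' A) ctx-shift
        (⊢-csub (exts σ) τ' ws' (WF-ren suc ∘ wt) D))
     (FreeTV-csub (exts σ) τ' f here)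
  where
  τ' = ren suc ∘ τ
  ws' : ∀ n → WF (exts σ n)
  ws' zero    = tv
  ws' (suc n) = WF-ren suc (ws n)
  ctx-shift : mapCtx (csub (exts σ) τ') (shiftCtx Γ) ≡ shiftCtx (mapCtx (csub σ τ) Γ)
  ctx-shift = trans (sym (map-∘ Γ))
              (trans (map-cong (λ p → cong (proj₁ p ,_) (csub-shift σ τ (proj₂ p))) Γ)
                     (map-∘ Γ))
⊢-csub σ τ ws wt (∀e {Γ = Γ} {t = t} {A = A} {C = C} D w) =
  subst (λ B → mapCtx (csub σ τ) Γ ⊢ t ∶ B) (sym (csub-inst σ τ A C))
    (∀e (⊢-csub σ τ ws wt D) (WF-csub σ τ ws wt w))

-- Generation lemma for λ-abstractions

data Inst : Ty → Ty → Set where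
  irefl : ∀ {A} → Inst A A
  istep : ∀ {A C U} → WF C → Inst (A [ C ]) U → Inst (∀' A) U

_•_ : Ty → (ℕ → Ty) → ℕ → Ty
(C • σ) zero    = C
(C • σ) (suc n) = σ n

inst-exts : ∀ σ C A → (csub (exts σ) tc A) [ C ] ≡ csub (C • σ) tc A
inst-exts σ C A =
  trans (sub-as-csub (single C) (csub (exts σ) tc A))
  (trans (csub-csub (single C) tc (exts σ) tc A) (csub-cong single-exts (λ _ → refl) A))
  where
  single-exts : ∀ n → csub (single C) tc (exts σ n) ≡ (C • σ) n
  single-exts zero    = refl
  single-exts (suc n) = inst-shifted C (σ n)

-- A derivation of λx s : T ends with →i followed by ∀i/∀e steps; the
-- substitution σ accounts for the variables generalised along the way.
generation : ∀ {Γ x s T} → Γ ⊢ lam x s ∶ T → (σ : ℕ → Ty) → (∀ n → WF (σ n)) →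
             ∀ {B C} → Inst (csub σ tc T) (B ⇒ C) → ((x , B) ∷ mapCtx (csub σ tc) Γ) ⊢ s ∶ C
generation (→i w D) σ ws irefl = ⊢-csub σ tc ws (λ _ → tc) D
generation {Γ} {x} {s} (∀i {A = A} D f) σ ws {B} {C} (istep {C = C'} w i) =
  subst (λ Δ → ((x , B) ∷ Δ) ⊢ s ∶ C) ctx-unshift
    (generation D (C' • σ) ws' (subst (λ U → Inst U (B ⇒ C)) (inst-exts σ C' A) i))
  where
  ws' : ∀ n → WF ((C' • σ) n)
  ws' zero    = w
  ws' (suc n) = ws n
  ctx-unshift : mapCtx (csub (C' • σ) tc) (shiftCtx Γ) ≡ mapCtx (csub σ tc) Γ
  ctx-unshift = trans (sym (map-∘ Γ))
                      (map-cong (λ p → cong (proj₁ p ,_) (csub-ren (C' • σ) tc suc (proj₂ p))) Γ)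
generation (∀e {A = A} {C = C'} D w) σ ws {B} {C} i =
  generation D σ ws
    (istep (WF-csub σ tc ws (λ _ → tc) w) (subst (λ U → Inst U (B ⇒ C)) (csub-inst σ tc A C') i))

lam-inversion : ∀ {Γ x s T B C} → Γ ⊢ lam x s ∶ T → Inst T (B ⇒ C) → ((x , B) ∷ Γ) ⊢ s ∶ C
lam-inversion {Γ} {x} {s} {T} {B} {C} D i =
  subst (λ Δ → ((x , B) ∷ Δ) ⊢ s ∶ C) ctx-id
    (generation D tv (λ _ → tv) (subst (λ U → Inst U (B ⇒ C)) (sym (csub-id T)) i))
  where
  ctx-id : mapCtx (csub tv tc) Γ ≡ Γ
  ctx-id = trans (map-cong (λ p → cong (proj₁ p ,_) (csub-id (proj₂ p))) Γ) (map-id Γ)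

-- Output types via a type constant: the converse of the generation lemma

abstractConst : ℕ → ℕ → Ty
abstractConst O c with c ≟ O
... | yes _ = tv zero
... | no _  = tc c

abstractConst-WF : ∀ O c → WF (abstractConst O c)
abstractConst-WF O c with c ≟ O
... | yes _ = tv
... | no _  = tc

abstractConst-self : ∀ O → abstractConst O O ≡ tv zero
abstractConst-self O with O ≟ O
... | yes _   = refl
... | no O≢O  = ⊥-elim (O≢O refl)

abstractConst-other : ∀ O c → c ≢ O → abstractConst O c ≡ tc c
abstractConst-other O c c≢O with c ≟ O
... | yes c≡O = ⊥-elim (c≢O c≡O)
... | no _    = refl

-- If x : O ⊢ t : S with S closed and free of O, then ⊢ λx t : ∀X (X → S):
-- abstract O into the fresh variable X throughout the derivation.
abstract-constant : ∀ {S O x t} → ClosedTy S → ¬ OccursTC O S →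
                    ((x , tc O) ∷ []) ⊢ t ∶ S → [] ⊢ lam x t ∶ ∀' (tv zero ⇒ ren suc S)
abstract-constant {S} {O} {x} {t} closed O∉S D =
  ∀i (→i tv (subst₂ (λ A B → ((x , A) ∷ []) ⊢ t ∶ B) (abstractConst-self O) S-fixed D')) (⇒ˡ here)
  where
  σ : ℕ → Ty
  σ n = tv (suc n)
  D' : ((x , abstractConst O O) ∷ []) ⊢ t ∶ csub σ (abstractConst O) S
  D' = ⊢-csub σ (abstractConst O) (λ _ → tv) (abstractConst-WF O) D
  fixes-S : ∀ {τ} → (∀ c → OccursTC c S → τ c ≡ tc c) → csub σ τ S ≡ S
  fixes-S = csub-fix σ _ S (λ n f → ⊥-elim (closed n f))
  S-fixed : csub σ (abstractConst O) S ≡ ren suc S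
  S-fixed = trans (fixes-S (λ c oc → abstractConst-other O c (λ c≡O →
                    O∉S (subst (λ c → OccursTC c S) c≡O oc))))
                  (sym (trans (ren-as-csub suc S) (fixes-S (λ _ _ → refl))))

-- The translation eliminating the variables of a context ending with O

maxBinder : Term → ℕ
maxBinder (var y)   = zero
maxBinder (lam x s) = x ⊔ maxBinder s
maxBinder (app u v) = maxBinder u ⊔ maxBinder v

-- Avoids α t: α is never bound by a λ in t, so α can be added to the
-- context of t without being shadowed.
data Avoids (α : ℕ) : Term → Set where
  var : ∀ {y} → Avoids α (var y)
  lam : ∀ {x s} → x ≢ α → Avoids α s → Avoids α (lam x s)
  app : ∀ {u v} → Avoids α u → Avoids α v → Avoids α (app u v)

avoids : ∀ {α} t → maxBinder t < α → Avoids α t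
avoids (var y)   _ = var
avoids (lam x s) p = lam (<⇒≢ (m⊔n<o⇒m<o x _ p)) (avoids s (m⊔n<o⇒n<o x _ p))
avoids (app u v) p = app (avoids u (m⊔n<o⇒m<o _ _ p)) (avoids v (m⊔n<o⇒n<o (maxBinder u) _ p))

-- O is the constant, α the fresh variable replacing the context.
module Elimination (O α : ℕ) where

  GoodTy : Ty → Set
  GoodTy T = WF T × EndsWith O T

  Good : ℕ × Ty → Set
  Good p = GoodTy (proj₂ p)

  good-inst : ∀ {A C} → GoodTy (∀' A) → WF C → GoodTy (A [ C ])
  good-inst {C = C} (∀' wA _ , all e) wC = WF-inst wA wC , EndsWith-sub (single C) e

  [α∶O] : Ctx
  [α∶O] = (α , tc O) ∷ []

  -- A type ending with O is inhabited, from α : O, by the normal term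
  -- λz₁…λzₖ α in which α is free.
  witness : ∀ {T} → EndsWith O T → Term
  witness base      = var α
  witness (arr B e) = lam (suc α) (witness e)
  witness (all e)   = witness e

  -- The binders of a witness never capture α.
  α≢1+α : α ≢ suc α
  α≢1+α = 1+n≢n ∘ sym

  witness-normal : ∀ {T} (e : EndsWith O T) → Normal (witness e)
  witness-normal base      = ne var
  witness-normal (arr B e) = lam (witness-normal e)
  witness-normal (all e)   = witness-normal e

  witness-fv : ∀ {T} (e : EndsWith O T) → α ∈Fv witness e
  witness-fv base      = var
  witness-fv (arr B e) = lam α≢1+α (witness-fv e)
  witness-fv (all e)   = witness-fv e

  witness-typed : ∀ {Δ T} (e : EndsWith O T) → WF T → Δ ∋ α ∶ tc O → Δ ⊢ witness e ∶ T
  witness-typed base      _          l = ax l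
  witness-typed (arr B e) (wB ⇒ wA)  l = →i wB (witness-typed e wA (there α≢1+α l))
  witness-typed (all e)   (∀' wA f)  l = ∀i (witness-typed e wA (lookup-map (ren suc) l)) f

  -- The invariant of the translation: Δ = Λ ++ Γ, where Λ collects the
  -- λ-bound variables passed so far (none named α) and Γ ends with O.
  record Split (Λ Δ : Ctx) : Set where
    field
      rest      : Ctx
      splits    : Δ ≡ Λ ++ rest
      rest-good : All Good rest
      α-fresh   : α ∉ names Λ
  open Split

  split-bind : ∀ {Λ Δ x B} → x ≢ α → Split Λ Δ → Split ((x , B) ∷ Λ) ((x , B) ∷ Δ)
  split-bind {x = x} {B} x≢α sp = record
    { rest = rest sp ; splits = cong ((x , B) ∷_) (splits sp) ; rest-good = rest-good sp
    ; α-fresh = λ { (here α≡x) → x≢α (sym α≡x) ; (there α∈Λ) → α-fresh sp α∈Λ } }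

  split-shift : ∀ {Λ Δ} → Split Λ Δ → Split (shiftCtx Λ) (shiftCtx Δ)
  split-shift {Λ} sp = record
    { rest = shiftCtx (rest sp)
    ; splits = trans (cong shiftCtx (splits sp)) (shift-++ Λ (rest sp))
    ; rest-good = map⁺ (All-map (λ (w , e) → WF-ren suc w , EndsWith-ren suc e) (rest-good sp))
    ; α-fresh = α-fresh sp ∘ subst (α ∈_) (names-shift Λ) }

  -- A translation of t : T over Λ: a term in the class N, typed with the
  -- Γ-part replaced by α : O, in which α is free as soon as some variable
  -- of t not declared in Λ is free in t.
  record Translation (N : Term → Set) (Λ : Ctx) (t : Term) (T : Ty) : Set where
    field
      term   : Term
      normal : N term
      typed  : (Λ ++ [α∶O]) ⊢ term ∶ T
      fv     : ∀ {y} → y ∈Fv t → y ∈ names Λ ⊎ α ∈Fv term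
  open Translation

  neutral⇒normal : ∀ {Λ t T} → Translation Neutral Λ t T → Translation Normal Λ t T
  neutral⇒normal r = record { term = term r ; normal = ne (normal r) ; typed = typed r ; fv = fv r }

  by-witness : ∀ {Λ Δ t T} → Split Λ Δ → GoodTy T → Translation Normal Λ t T
  by-witness {Λ} sp (w , e) = record
    { term = witness e ; normal = witness-normal e
    ; typed = witness-typed e w (lookup-last Λ (α-fresh sp)) ; fv = λ _ → inj₂ (witness-fv e) }

  translation-lam : ∀ {Λ x s B C} → x ≢ α → WF B →
                    Translation Normal ((x , B) ∷ Λ) s C → Translation Normal Λ (lam x s) (B ⇒ C)
  translation-lam {Λ} {x} x≢α w r = record
    { term = lam x (term r) ; normal = lam (normal r) ; typed = →i w (typed r) ; fv = fv-lam }
    where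
    fv-lam : ∀ {y} → y ∈Fv lam x _ → y ∈ names Λ ⊎ α ∈Fv lam x (term r)
    fv-lam (lam y≢x y∈s) with fv r y∈s
    ... | inj₁ (here y≡x)   = ⊥-elim (y≢x y≡x)
    ... | inj₁ (there y∈Λ) = inj₁ y∈Λ
    ... | inj₂ α∈          = inj₂ (lam (x≢α ∘ sym) α∈)

  translation-app : ∀ {Λ u v B C} → Translation Neutral Λ u (B ⇒ C) →
                    Translation Normal Λ v B → Translation Neutral Λ (app u v) C
  translation-app r₁ r₂ = record
    { term = app (term r₁) (term r₂) ; normal = app (normal r₁) (normal r₂)
    ; typed = →e (typed r₁) (typed r₂) ; fv = λ { (appˡ y∈) → map₂ appˡ (fv r₁ y∈)
                                                ; (appʳ y∈) → map₂ appʳ (fv r₂ y∈) } }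

  translation-∀i : ∀ {N Λ t A} → FreeTV zero A →
                   Translation N (shiftCtx Λ) t A → Translation N Λ t (∀' A)
  translation-∀i {Λ = Λ} {A = A} f r = record
    { term = term r ; normal = normal r
    ; typed = ∀i (subst (λ Δ → Δ ⊢ term r ∶ A) (sym (shift-++ Λ [α∶O])) (typed r)) f
    ; fv = subst (λ ns → _ ∈ ns ⊎ α ∈Fv term r) (names-shift Λ) ∘ fv r }

  translation-∀e : ∀ {N Λ t A C} → WF C → Translation N Λ t (∀' A) → Translation N Λ t (A [ C ])
  translation-∀e w r = record { term = term r ; normal = normal r ; typed = ∀e (typed r) w ; fv = fv r }

  -- Translation of normal terms, and of neutral terms, whose type ends with O
  -- (and is well formed) when their head variable belongs to Γ.
  translate : ∀ {Λ Δ t T} → Split Λ Δ → Avoids α t → Normal t →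
              Δ ⊢ t ∶ T → Translation Normal Λ t T
  translate-ne : ∀ {Λ Δ t T} → Split Λ Δ → Avoids α t → Neutral t →
                 Δ ⊢ t ∶ T → GoodTy T ⊎ Translation Neutral Λ t T

  translate sp av (ne n) D = [ by-witness sp , neutral⇒normal ]′ (translate-ne sp av n D)
  translate sp (lam x≢α av) (lam n) (→i w D) =
    translation-lam x≢α w (translate (split-bind x≢α sp) av n D)
  translate sp av (lam n) (∀i D f) = translation-∀i f (translate (split-shift sp) av (lam n) D)
  translate sp av (lam n) (∀e D w) = translation-∀e w (translate sp av (lam n) D)

  translate-ne {Λ} sp av var (ax l) with lookup-++ Λ (subst (λ Δ → Δ ∋ _ ∶ _) (splits sp) l)
  ... | inj₁ (y∈Λ , l') =
    inj₂ (record { term = var _ ; normal = var ; typed = ax l' ; fv = λ { var → inj₁ y∈Λ } })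
  ... | inj₂ l'         = inj₁ (lookup-All l' (rest-good sp))
  translate-ne sp (app avu avv) (app nu nv) (→e D E) with translate-ne sp avu nu D
  ... | inj₁ (_ ⇒ w , arr _ e) = inj₁ (w , e)
  ... | inj₂ r                 = inj₂ (translation-app r (translate sp avv nv E))
  translate-ne sp av n (∀i D f) with translate-ne (split-shift sp) av n D
  ... | inj₁ (w , e) = inj₁ (∀' w f , all e)
  ... | inj₂ r       = inj₂ (translation-∀i f r)
  translate-ne sp av n (∀e D w) with translate-ne sp av n D
  ... | inj₁ good = inj₁ (good-inst good w)
  ... | inj₂ r    = inj₂ (translation-∀e w r)

  eliminate : ∀ {Γ t T} → All Good Γ → Avoids α t → Normal t → Γ ⊢ t ∶ T →
              Translation Normal [] t T
  eliminate good = translate (record { rest = _ ; splits = refl ; rest-good = good ; α-fresh = λ () })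

theorem2p1p1 : (S : Ty) (O : ℕ) → WF S → ClosedTy S → ¬ OccursTC O S →
    Output S ⇔
      (∀ (t : Term) → Normal t → (Γ : List (ℕ × Ty)) →
        All (λ p → WF (proj₂ p) × EndsWith O (proj₂ p)) Γ →
        Γ ⊢ t ∶ S → All (λ p → ¬ (proj₁ p ∈Fv t)) Γ)
theorem2p1p1 S O _ closed O∉S = mk⇔ forward backward
  where
  NoContextVariableFree : Set
  NoContextVariableFree = ∀ (t : Term) → Normal t → (Γ : List (ℕ × Ty)) →
    All (λ p → WF (proj₂ p) × EndsWith O (proj₂ p)) Γ →
    Γ ⊢ t ∶ S → All (λ p → ¬ (proj₁ p ∈Fv t)) Γ

  forward : Output S → NoContextVariableFree
  forward out t nt Γ good D = tabulate (λ _ → t-closed _)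
    where
    α : ℕ
    α = suc (maxBinder t)
    open Elimination O α using (Translation; eliminate)
    r : Translation Normal [] t S
    r = eliminate good (avoids t (n<1+n _)) nt D
    open Translation r
    t-closed : ∀ y → ¬ y ∈Fv t
    t-closed y y∈ = [ (λ ()) , out α term normal (abstract-constant closed O∉S typed) ]′ (fv y∈)

  backward : NoContextVariableFree → Output S
  backward noFv x t nt D = head (noFv t nt ((x , tc O) ∷ []) ((tc , base) ∷ []) D')
    where
    inst-O : Inst (∀' (tv zero ⇒ ren suc S)) (tc O ⇒ S)
    inst-O = istep tc (subst (λ U → Inst U (tc O ⇒ S)) (cong (tc O ⇒_) (sym shifted-S)) irefl)
      where
      shifted-S : (ren suc S) [ tc O ] ≡ S
      shifted-S = trans (sub-as-csub (single (tc O)) (ren suc S)) (inst-shifted (tc O) S)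
    D' : ((x , tc O) ∷ []) ⊢ t ∶ S
    D' = lam-inversion D inst-O
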